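{- Let $D=\{2^i\mid i\in\mathbb{Z}_{\ge0}\}$. Let $\mathbf{s}=s_1\dots s_l$ be a binary string and $\mathbf{s}^{(1)}=s^{(1)}_1\dots s^{(1)}_{4l}$ its expansion. Let $x,y\in\{1,\dots,4l\}$ be positive integers with $y-x\in D$ and $s^{(1)}_x=s^{(1)}_y$. If $s_{\mathrm{pos}(x)}\neq s_{\mathrm{pos}(y)}$, then $s_{\mathrm{pos}(x)}=1-s^{(1)}_x$, $s_{\mathrm{pos}(y)}=s^{(1)}_y$, and $\mathrm{pos}(y)=\mathrm{pos}(x)+1$.
   Context: The expansion of a binary string $\mathbf{s}$ of length $l$ is the binary string $\mathbf{s}^{(1)}$ of length $4l$ obtained by replacing each $0$ in $\mathbf{s}$ by the block $0011$ and each $1$ by the block $1100$; equivalently, for $i\in\{1,\dots,l\}$ and $j\in\{0,1,2,3\}$, $s^{(1)}_{4i-j}=s_i$ if $j\in\{2,3\}$ and $s^{(1)}_{4i-j}=1-s_i$ if $j\in\{0,1\}$. For a positive integer $i$, $\mathrm{pos}(i)=\lceil i/4\rceil$. -}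

module Defs where

open import Data.Nat using (ℕ; zero; suc; _+_; _*_; _∸_; _^_; _≤_; _<_)
open import Data.Nat.DivMod using (_/_)
open import Data.Bool using (Bool; true; false; not)
open import Data.Vec using (Vec; []; _∷_; _++_; lookup; concat; map)
open import Data.Fin using (Fin; fromℕ<)
open import Data.Product using (∃-syntax)
open import Relation.Binary.PropositionalEquality using (_≡_)

InD : ℕ → Set
InD d = ∃[ i ] d ≡ 2 ^ i

-- bits: false = 0, true = 1.  1 - b is `not b`.
-- block replacing a single bit: 0 ↦ 0011, 1 ↦ 1100
block : Bool → Vec Bool 4
block b = b ∷ b ∷ not b ∷ not b ∷ []

expand : ∀ {l} → Vec Bool l → Vec Bool (l * 4)
expand s = concat (map block s)

-- 1-based access: the i-th symbol (1 ≤ i ≤ n) of a string of length n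
at : ∀ {n} → Vec Bool n → (i : ℕ) → 1 ≤ i → i ≤ n → Bool
at {n} v (suc i) _ i<n = lookup v (fromℕ< i<n)

pos : ℕ → ℕ
pos i = (i + 3) / 4

{-# OPTIONS --safe #-}
module Submission where

open import Defs
open import Data.Nat using (ℕ; suc; _+_; _*_; _∸_; _≤_; _<_; _^_; z≤n; s≤s; z<s; NonZero)
open import Data.Nat.Properties
open import Data.Nat.DivMod
open import Data.Nat.Divisibility using (n∣m*n)
open import Data.Bool using (Bool; not)
open import Data.Bool.Properties using (not-involutive; not-injective)
open import Data.Vec using (Vec; lookup; map; concat)
open import Data.Vec.Properties using (lookup-concat; lookup-map)
open import Data.Fin using (Fin; toℕ; fromℕ<; combine)
open import Data.Fin.Properties using (toℕ-injective; toℕ-fromℕ<; toℕ-combine)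
open import Data.Product using (_×_; _,_; proj₁; proj₂)
open import Data.Empty using (⊥)
open import Relation.Nullary using (contradiction)
open import Relation.Binary.PropositionalEquality

-- Write a position as 4 a + o + 1 with 0 ≤ o < 4: it lies in block a + 1 at offset o.
-- Offsets 0, 1 of a block carry the source bit and offsets 2, 3 its negation, so
-- equal expanded bits over different source bits lie in different blocks at offsets
-- of different halves.  In particular the gap y - x is not a multiple of 4; being a
-- power of 2 it is 1 or 2, and such a step leaves a block only from its upper half
-- and only into the lower half of the next block.

m+n≡[m%d+n]+m/d*d : ∀ m n d .{{_ : NonZero d}} → m + n ≡ (m % d + n) + m / d * d
m+n≡[m%d+n]+m/d*d m n d = begin
  m + n                     ≡⟨ cong (_+ n) (m≡m%n+[m/n]*n m d) ⟩
  (m % d + m / d * d) + n   ≡⟨ +-assoc (m % d) (m / d * d) n ⟩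
  m % d + (m / d * d + n)   ≡⟨ cong (m % d +_) (+-comm (m / d * d) n) ⟩
  m % d + (n + m / d * d)   ≡⟨ +-assoc (m % d) n (m / d * d) ⟨
  (m % d + n) + m / d * d   ∎
  where open ≡-Reasoning

[m+n]/d≡m/d+[m%d+n]/d : ∀ m n d .{{_ : NonZero d}} → (m + n) / d ≡ m / d + (m % d + n) / d
[m+n]/d≡m/d+[m%d+n]/d m n d = begin
  (m + n) / d                      ≡⟨ cong (_/ d) (m+n≡[m%d+n]+m/d*d m n d) ⟩
  (m % d + n + m / d * d) / d      ≡⟨ +-distrib-/-∣ʳ (m % d + n) (n∣m*n (m / d)) ⟩
  (m % d + n) / d + m / d * d / d  ≡⟨ cong ((m % d + n) / d +_) (m*n/n≡m (m / d) d) ⟩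
  (m % d + n) / d + m / d          ≡⟨ +-comm ((m % d + n) / d) (m / d) ⟩
  m / d + (m % d + n) / d          ∎
  where open ≡-Reasoning

[m+n]%d≡[m%d+n]%d : ∀ m n d .{{_ : NonZero d}} → (m + n) % d ≡ (m % d + n) % d
[m+n]%d≡[m%d+n]%d m n d =
  trans (cong (_% d) (m+n≡[m%d+n]+m/d*d m n d)) ([m+kn]%n≡m%n (m % d + n) (m / d) d)

pos-suc : ∀ i → pos (suc i) ≡ suc (i / 4)
pos-suc i = begin
  (suc i + 3) / 4  ≡⟨ cong (_/ 4) (+-suc i 3) ⟨
  (i + 4) / 4      ≡⟨ +-distrib-/-∣ʳ i (n∣m*n 1) ⟩
  i / 4 + 1        ≡⟨ +-comm (i / 4) 1 ⟩
  suc (i / 4)      ∎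
  where open ≡-Reasoning

pos-next-block : ∀ i j → j / 4 ≡ suc (i / 4) → pos (suc j) ≡ pos (suc i) + 1
pos-next-block i j next = begin
  pos (suc j)        ≡⟨ pos-suc j ⟩
  suc (j / 4)        ≡⟨ cong suc next ⟩
  suc (suc (i / 4))  ≡⟨ +-comm 1 (suc (i / 4)) ⟩
  suc (i / 4) + 1    ≡⟨ cong (_+ 1) (pos-suc i) ⟨
  pos (suc i) + 1    ∎
  where open ≡-Reasoning

offset-carry : ∀ r d → r < 4 → d ≤ 2 → (r + d) / 4 ≢ 0 → 2 ≤ r × (r + d) % 4 < 2 × (r + d) / 4 ≡ 1
offset-carry 2 2 _ _ _ = ≤-refl , z<s , refl
offset-carry 3 1 _ _ _ = s≤s (s≤s z≤n) , z<s , refl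
offset-carry 3 2 _ _ _ = s≤s (s≤s z≤n) , s≤s z<s , refl
offset-carry 0 0 _ _ no-carry = contradiction refl no-carry
offset-carry 0 1 _ _ no-carry = contradiction refl no-carry
offset-carry 0 2 _ _ no-carry = contradiction refl no-carry
offset-carry 1 0 _ _ no-carry = contradiction refl no-carry
offset-carry 1 1 _ _ no-carry = contradiction refl no-carry
offset-carry 1 2 _ _ no-carry = contradiction refl no-carry
offset-carry 2 0 _ _ no-carry = contradiction refl no-carry
offset-carry 2 1 _ _ no-carry = contradiction refl no-carry
offset-carry 3 0 _ _ no-carry = contradiction refl no-carry
offset-carry (suc (suc (suc (suc _)))) _ (s≤s (s≤s (s≤s (s≤s ())))) _ _
offset-carry _ (suc (suc (suc _))) _ (s≤s (s≤s ())) _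

short-step-crossing : ∀ i d → d ≤ 2 → i / 4 ≢ (i + d) / 4 →
                      2 ≤ i % 4 × (i + d) % 4 < 2 × (i + d) / 4 ≡ suc (i / 4)
short-step-crossing i d d≤2 block≢ = crossing (offset-carry (i % 4) d (m%n<n i 4) d≤2 carries)
  where
  next-block : (i + d) / 4 ≡ i / 4 + (i % 4 + d) / 4
  next-block = [m+n]/d≡m/d+[m%d+n]/d i d 4
  carries : (i % 4 + d) / 4 ≢ 0
  carries no-carry = block≢ (sym (trans next-block (trans (cong (i / 4 +_) no-carry) (+-identityʳ (i / 4)))))
  crossing : 2 ≤ i % 4 × (i % 4 + d) % 4 < 2 × (i % 4 + d) / 4 ≡ 1 →
             2 ≤ i % 4 × (i + d) % 4 < 2 × (i + d) / 4 ≡ suc (i / 4)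
  crossing (high , low , one) =
    high ,
    subst (_< 2) (sym ([m+n]%d≡[m%d+n]%d i d 4)) low ,
    trans next-block (trans (cong (i / 4 +_) one) (+-comm (i / 4) 1))

power-step-crossing : ∀ i {d} → InD d → i / 4 ≢ (i + d) / 4 → i % 4 ≢ (i + d) % 4 →
                      2 ≤ i % 4 × (i + d) % 4 < 2 × (i + d) / 4 ≡ suc (i / 4)
power-step-crossing i (0 , refl) block≢ _ = short-step-crossing i 1 (s≤s z≤n) block≢
power-step-crossing i (1 , refl) block≢ _ = short-step-crossing i 2 ≤-refl block≢
power-step-crossing i (suc (suc k) , refl) _ offset≢ = contradiction (sym same-offset) offset≢
  where
  2^[2+k]≡2^k*4 : 2 ^ (2 + k) ≡ 2 ^ k * 4
  2^[2+k]≡2^k*4 = trans (^-distribˡ-+-* 2 2 k) (*-comm 4 (2 ^ k))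
  same-offset : (i + 2 ^ (2 + k)) % 4 ≡ i % 4
  same-offset = trans (cong (λ d → (i + d) % 4) 2^[2+k]≡2^k*4) ([m+kn]%n≡m%n i (2 ^ k) 4)

block-crossing : ∀ {i j} → i ≤ j → InD (j ∸ i) → i / 4 ≢ j / 4 → i % 4 ≢ j % 4 →
                 2 ≤ i % 4 × j % 4 < 2 × j / 4 ≡ suc (i / 4)
block-crossing {i} {j} i≤j with j ∸ i | m+[n∸m]≡n i≤j
... | d | refl = power-step-crossing i

lookup-block-low : ∀ b i → i % 4 < 2 → lookup (block b) (i mod 4) ≡ b
lookup-block-low b i r<2 with i % 4 | m%n<n i 4 | r<2
... | 0 | _ | _ = refl
... | 1 | _ | _ = refl
... | suc (suc _) | _ | s≤s (s≤s ())

lookup-block-high : ∀ b i → 2 ≤ i % 4 → lookup (block b) (i mod 4) ≡ not b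
lookup-block-high b i 2≤r with i % 4 | m%n<n i 4 | 2≤r
... | 2 | _ | _ = refl
... | 3 | _ | _ = refl
... | 1 | _ | s≤s ()
... | suc (suc (suc (suc _))) | s≤s (s≤s (s≤s (s≤s ()))) | _

lookup-block-injective : ∀ {b c} i j → i % 4 ≡ j % 4 →
                         lookup (block b) (i mod 4) ≡ lookup (block c) (j mod 4) → b ≡ c
lookup-block-injective i j r≡r′ eq with i % 4 | m%n<n i 4 | j % 4 | m%n<n j 4 | r≡r′ | eq
... | 0 | _ | _ | _ | refl | eq′ = eq′
... | 1 | _ | _ | _ | refl | eq′ = eq′
... | 2 | _ | _ | _ | refl | eq′ = not-injective eq′
... | 3 | _ | _ | _ | refl | eq′ = not-injective eq′
... | suc (suc (suc (suc _))) | s≤s (s≤s (s≤s (s≤s ()))) | _ | _ | _ | _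

at-cong : ∀ {n} (v : Vec Bool n) {i j} {p : 1 ≤ i} {q : i ≤ n} {p′ : 1 ≤ j} {q′ : j ≤ n} →
          i ≡ j → at v i p q ≡ at v j p′ q′
at-cong v {p = s≤s z≤n} refl = refl

fromℕ<≡combine-/-mod : ∀ {l i} (i<l*4 : i < l * 4) →
                       fromℕ< i<l*4 ≡ combine (fromℕ< (m<n*o⇒m/o<n {n = l} i<l*4)) (i mod 4)
fromℕ<≡combine-/-mod {l} {i} i<l*4 = toℕ-injective (begin
  toℕ (fromℕ< i<l*4)              ≡⟨ toℕ-fromℕ< i<l*4 ⟩
  i                               ≡⟨ m≡m%n+[m/n]*n i 4 ⟩
  i % 4 + i / 4 * 4               ≡⟨ +-comm (i % 4) (i / 4 * 4) ⟩
  i / 4 * 4 + i % 4               ≡⟨ cong (_+ i % 4) (*-comm (i / 4) 4) ⟩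
  4 * (i / 4) + i % 4             ≡⟨ cong₂ (λ a o → 4 * a + o) (toℕ-fromℕ< i/4<l) (toℕ-fromℕ< (m%n<n i 4)) ⟨
  4 * toℕ a + toℕ (i mod 4)      ≡⟨ toℕ-combine a (i mod 4) ⟨
  toℕ (combine a (i mod 4))      ∎)
  where
  open ≡-Reasoning
  i/4<l : i / 4 < l
  i/4<l = m<n*o⇒m/o<n {n = l} i<l*4
  a : Fin l
  a = fromℕ< i/4<l

at-expand : ∀ {l} (s : Vec Bool l) i {p′ q′} (q : suc i ≤ l * 4) →
            at (expand s) (suc i) (s≤s z≤n) q ≡ lookup (block (at s (pos (suc i)) p′ q′)) (i mod 4)
at-expand {l} s i q = begin
  lookup (expand s) (fromℕ< q)                    ≡⟨ cong (lookup (expand s)) (fromℕ<≡combine-/-mod {l} q) ⟩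
  lookup (concat (map block s)) (combine a o)     ≡⟨ lookup-concat (map block s) a o ⟩
  lookup (lookup (map block s) a) o               ≡⟨ cong (λ v → lookup v o) (lookup-map a block s) ⟩
  lookup (block (lookup s a)) o                   ≡⟨ cong (λ b → lookup (block b) o) a≡pos ⟩
  lookup (block (at s (pos (suc i)) _ _)) o       ∎
  where
  open ≡-Reasoning
  i/4<l : i / 4 < l
  i/4<l = m<n*o⇒m/o<n {n = l} q
  a : Fin l
  a = fromℕ< i/4<l
  o : Fin 4
  o = i mod 4
  a≡pos : ∀ {p′ q′} → lookup s a ≡ at s (pos (suc i)) p′ q′
  a≡pos = at-cong s {p = s≤s z≤n} {q = i/4<l} (sym (pos-suc i))

proposition1 : (l : ℕ) (s : Vec Bool l) (x y : ℕ)
    (1≤x : 1 ≤ x) (x≤4l : x ≤ l * 4) (1≤y : 1 ≤ y) (y≤4l : y ≤ l * 4)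
    (1≤px : 1 ≤ pos x) (px≤l : pos x ≤ l) (1≤py : 1 ≤ pos y) (py≤l : pos y ≤ l) →
    x ≤ y → InD (y ∸ x) →
    at (expand s) x 1≤x x≤4l ≡ at (expand s) y 1≤y y≤4l →
    (at s (pos x) 1≤px px≤l ≡ at s (pos y) 1≤py py≤l → ⊥) →
    (at s (pos x) 1≤px px≤l ≡ not (at (expand s) x 1≤x x≤4l))
    × (at s (pos y) 1≤py py≤l ≡ at (expand s) y 1≤y y≤4l)
    × (pos y ≡ pos x + 1)
proposition1 l s (suc i) (suc j) (s≤s z≤n) x≤4l (s≤s z≤n) y≤4l 1≤px px≤l 1≤py py≤l
  (s≤s i≤j) j∸i∈D same-bit source-bits-differ = source-x , source-y , pos-y
  where
  u w : Bool
  u = at s (pos (suc i)) 1≤px px≤l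
  w = at s (pos (suc j)) 1≤py py≤l
  bit-x : at (expand s) (suc i) (s≤s z≤n) x≤4l ≡ lookup (block u) (i mod 4)
  bit-x = at-expand s i x≤4l
  bit-y : at (expand s) (suc j) (s≤s z≤n) y≤4l ≡ lookup (block w) (j mod 4)
  bit-y = at-expand s j y≤4l
  block≢ : i / 4 ≢ j / 4
  block≢ eq = source-bits-differ (at-cong s (trans (pos-suc i) (trans (cong suc eq) (sym (pos-suc j)))))
  offset≢ : i % 4 ≢ j % 4
  offset≢ eq = source-bits-differ (lookup-block-injective i j eq (trans (sym bit-x) (trans same-bit bit-y)))
  crossing : 2 ≤ i % 4 × j % 4 < 2 × j / 4 ≡ suc (i / 4)
  crossing = block-crossing i≤j j∸i∈D block≢ offset≢
  source-x : u ≡ not (at (expand s) (suc i) (s≤s z≤n) x≤4l)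
  source-x = sym (trans (cong not (trans bit-x (lookup-block-high u i (proj₁ crossing)))) (not-involutive u))
  source-y : w ≡ at (expand s) (suc j) (s≤s z≤n) y≤4l
  source-y = sym (trans bit-y (lookup-block-low w j (proj₁ (proj₂ crossing))))
  pos-y : pos (suc j) ≡ pos (suc i) + 1
  pos-y = pos-next-block i j (proj₂ (proj₂ crossing))
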